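{- Let $H=(V,E)$ be a graph, $M\in\mathbb{N}$, $V=\bigcup_{i<M}W_i$, and for each $i<M$ let $H_i=(V,E_i)$ with $E_i\subseteq E$. If Bob has a winning strategy in the game $G(H_i,W_i,k)$ for every $i<M$, then $V$ can be partitioned into sets $\{P_i:i<M\}$ such that each $P_i$ is (the vertex set of) a $k^{th}$ power of a path in $H_i$, i.e. $H_i[P_i]$ contains the $k^{th}$ power of a finite or one-way infinite Hamiltonian path of $P_i$.
   Context: For a graph $H$, $W\subseteq V(H)$ and $k\in\mathbb{N}$, the game $G(H,W,k)$ is played by Adam and Bob, who alternately choose pairwise disjoint finite subsets $A_0,B_0,A_1,B_1,\dots$ of $V(H)$ (Adam chooses the $A_i$, Bob the $B_i$). Bob wins iff (A) $W\subseteq\bigcup_{i\in\mathbb{N}}(A_i\cup B_i)$, and (B) the induced subgraph $H[\bigcup_i B_i]$ contains the $k^{th}$ power of a (finite or one-way infinite) Hamiltonian path, i.e. $\bigcup_iB_i$ can be enumerated as a finite or one-way infinite sequence $v_0,v_1,\dots$ of distinct vertices with $\{v_i,v_j\}$ an edge of $H$ whenever $1\le|i-j|\le k$. -}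

module Defs where

open import Data.Nat using (ℕ; _<_; _≤_; _+_)
open import Data.Fin using (Fin; toℕ)
open import Data.Vec using (Vec; tabulate)
open import Data.List using (List)
open import Data.List.Membership.Propositional using (_∈_)
open import Data.Product using (Σ; ∃; _×_; _,_)
open import Data.Sum using (_⊎_)
open import Relation.Nullary using (¬_)
open import Relation.Binary.PropositionalEquality using (_≡_)

record SimpleGraph (V : Set) : Set₁ where
  field
    Adj    : V → V → Set
    sym    : ∀ {u v} → Adj u v → Adj v u
    irrefl : ∀ {v} → ¬ Adj v v
open SimpleGraph public

_⊆ᴱ_ : {V : Set} → SimpleGraph V → SimpleGraph V → Set
G ⊆ᴱ H = ∀ {u v} → Adj G u v → Adj H u v

FinKPowerHamPath : {V : Set} → SimpleGraph V → ℕ → (V → Set) → Set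
FinKPowerHamPath {V} G k S =
  Σ ℕ λ N → Σ (Fin N → V) λ f →
    (∀ i j → f i ≡ f j → i ≡ j) ×
    (∀ i → S (f i)) ×
    (∀ v → S v → ∃ λ i → f i ≡ v) ×
    (∀ i j → toℕ i < toℕ j → toℕ j ≤ toℕ i + k → Adj G (f i) (f j))

InfKPowerHamPath : {V : Set} → SimpleGraph V → ℕ → (V → Set) → Set
InfKPowerHamPath {V} G k S =
  Σ (ℕ → V) λ f →
    (∀ i j → f i ≡ f j → i ≡ j) ×
    (∀ i → S (f i)) ×
    (∀ v → S v → ∃ λ i → f i ≡ v) ×
    (∀ i j → i < j → j ≤ i + k → Adj G (f i) (f j))

HasKPowerHamPath : {V : Set} → SimpleGraph V → ℕ → (V → Set) → Set
HasKPowerHamPath G k S = FinKPowerHamPath G k S ⊎ InfKPowerHamPath G k S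

-- The game G(H,W,k).  Finite sets are represented by lists.
-- Adam plays A_0, A_1, …; Bob plays B_0, B_1, …, B_n chosen after A_n.

-- A strategy for Bob: B_n as a function of Adam's moves A_0,…,A_n
-- (Bob's own earlier moves are determined by these via the strategy).
BobStrategy : Set → Set
BobStrategy V = (n : ℕ) → Vec (List V) (Data.Nat.suc n) → List V

prefix : {V : Set} → (ℕ → List V) → (n : ℕ) → Vec (List V) (Data.Nat.suc n)
prefix A n = tabulate (λ j → A (toℕ j))

bobMoves : {V : Set} → BobStrategy V → (ℕ → List V) → ℕ → List V
bobMoves σ A n = σ n (prefix A n)

PlayedBefore : {V : Set} → (ℕ → List V) → (ℕ → List V) → ℕ → V → Set
PlayedBefore A B n v = ∃ λ j → j < n × (v ∈ A j ⊎ v ∈ B j)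

AdamLegal : {V : Set} → (ℕ → List V) → (ℕ → List V) → Set
AdamLegal A B = ∀ n v → v ∈ A n → ¬ PlayedBefore A B n v

BobLegal : {V : Set} → (ℕ → List V) → (ℕ → List V) → Set
BobLegal A B = ∀ n v → v ∈ B n → ¬ PlayedBefore A B n v × ¬ (v ∈ A n)

BobWins : {V : Set} → SimpleGraph V → (V → Set) → ℕ →
          (ℕ → List V) → (ℕ → List V) → Set
BobWins G W k A B =
  (∀ w → W w → ∃ λ n → w ∈ A n ⊎ w ∈ B n) ×
  HasKPowerHamPath G k (λ v → ∃ λ n → v ∈ B n)

BobHasWinningStrategy : {V : Set} → SimpleGraph V → (V → Set) → ℕ → Set
BobHasWinningStrategy {V} G W k =
  Σ (BobStrategy V) λ σ → ∀ (A : ℕ → List V) →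
    AdamLegal A (bobMoves σ A) →
    BobLegal A (bobMoves σ A) × BobWins G W k A (bobMoves σ A)

module Submission where

-- Bob plays the M games G(Hᵢ,Wᵢ,k) simultaneously,
-- interleaved in rounds: global time t = n·M + i is round n of game i.  At that
-- time Adam's move in game i is everything Bob has claimed, in any game, since
-- the previous round of game i (the last M-1 global moves), and Bob answers with
-- his winning strategy σᵢ.  The global play is defined by course-of-values
-- recursion, since each move only consults earlier moves.
--
-- By strong induction on t every global move is disjoint from all earlier ones:
-- up to the current round Adam has played legally in game i, and a strategy
-- answering legal plays legally answers legally as long as Adam has so far
-- been legal.  So every simulated play is a legal play of game i, which Bob
-- wins.  Let Pᵢ be the set of Bob's vertices in game i: these sets are disjoint
-- (distinct global moves are disjoint), they cover V (each w ∈ Wᵢ is claimed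
-- in game i by Adam, i.e. by Bob in another game, or by Bob himself), and Pᵢ
-- carries a k-th power of a Hamiltonian path because Bob wins game i.  With no games the covering hypothesis
-- makes V empty.

open import Defs hiding (sym)
open import Data.Nat using (ℕ; zero; suc; _+_; _*_; _≤_; _<_; z≤n; s≤s; _≤?_; _<?_)
open import Data.Nat.Properties
open import Data.Nat.DivMod using (_/_; _%_; _mod_; m≡m%n+[m/n]*n; m<n⇒m%n≡m; [m+kn]%n≡m%n; +-distrib-/; m<n⇒m/n≡0; m*n/n≡m; m*n%n≡0)
open import Data.Nat.Induction using (<-rec)
open import Data.Fin using (Fin; toℕ)
open import Data.Fin.Properties using (toℕ-fromℕ<; toℕ-injective; toℕ<n; toℕ≤pred[n])
open import Data.Vec.Properties using (tabulate-cong)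
open import Data.List using (List; []; _∷_; map; concat; concatMap)
open import Data.List.Properties using (map-cong-local)
import Data.List.Relation.Unary.All as All
open import Data.List.Membership.Propositional using (_∈_)
open import Data.List.Membership.Propositional.Properties using (∈-map⁺; ∈-map⁻; ∈-concat⁺′; ∈-concat⁻′)
open import Data.List.Relation.Unary.Any using (here; there)
open import Data.Product using (Σ; ∃; _×_; _,_; proj₁; proj₂)
open import Data.Sum using (_⊎_; inj₁; inj₂)
open import Data.Empty using (⊥; ⊥-elim)
open import Relation.Nullary using (¬_; yes; no; contradiction)
open import Relation.Binary using (tri<; tri≈; tri>)
open import Relation.Binary.PropositionalEquality

-- A step function that only consults the values before time t determines a
-- sequence satisfying x t ≡ step t x.  The value x₀ pads the finite histories.
module CourseOfValues {X : Set} (x₀ : X) (step : ℕ → (ℕ → X) → X)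
  (step-local : ∀ t h h′ → (∀ s → s < t → h s ≡ h′ s) → step t h ≡ step t h′) where

  history : ℕ → ℕ → X
  history zero    s = x₀
  history (suc t) s with s <? t
  ... | yes _ = history t s
  ... | no  _ = step t (history t)

  sequence : ℕ → X
  sequence t = step t (history t)

  history-correct : ∀ t s → s < t → history t s ≡ sequence s
  history-correct (suc t) s s<1+t with s <? t
  ... | yes s<t = history-correct t s s<t
  ... | no  s≮t rewrite ≤-antisym (≤-pred s<1+t) (≮⇒≥ s≮t) = refl

  sequence-recurrence : ∀ t → sequence t ≡ step t sequence
  sequence-recurrence t = step-local t (history t) sequence (history-correct t)

module _ {V : Set} where

  bobMoves-local : (σ : BobStrategy V) (A A′ : ℕ → List V) (n : ℕ) →
    (∀ j → j ≤ n → A j ≡ A′ j) → bobMoves σ A n ≡ bobMoves σ A′ n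
  bobMoves-local σ A A′ n agree =
    cong (σ n) (tabulate-cong (λ j → agree (toℕ j) (toℕ≤pred[n] j)))

  playedBefore-local : (A B A′ B′ : ℕ → List V) (n : ℕ) {v : V} →
    (∀ j → j < n → A j ≡ A′ j) → (∀ j → j < n → B j ≡ B′ j) →
    PlayedBefore A B n v → PlayedBefore A′ B′ n v
  playedBefore-local A B A′ B′ n {v} agreeA agreeB (j , j<n , inj₁ v∈A) =
    j , j<n , inj₁ (subst (v ∈_) (agreeA j j<n) v∈A)
  playedBefore-local A B A′ B′ n {v} agreeA agreeB (j , j<n , inj₂ v∈B) =
    j , j<n , inj₂ (subst (v ∈_) (agreeB j j<n) v∈B)

  truncate : (ℕ → List V) → ℕ → ℕ → List V
  truncate A n j with j ≤? n
  ... | yes _ = A j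
  ... | no  _ = []

  truncate-below : ∀ A n j → j ≤ n → truncate A n j ≡ A j
  truncate-below A n j j≤n with j ≤? n
  ... | yes _   = refl
  ... | no  j≰n = contradiction j≤n j≰n

  AdamLegalUpTo : (ℕ → List V) → (ℕ → List V) → ℕ → Set
  AdamLegalUpTo A B n = ∀ j → j ≤ n → ∀ v → v ∈ A j → ¬ PlayedBefore A B j v

  -- If σ answers every legal play of Adam legally, then its n-th move is legal
  -- whenever Adam has been legal up to round n: compare with the play in which
  -- Adam passes after round n, which is legal and agrees up to round n.
  bob-legal-upTo : (σ : BobStrategy V) →
    (∀ A → AdamLegal A (bobMoves σ A) → BobLegal A (bobMoves σ A)) →
    ∀ A n → AdamLegalUpTo A (bobMoves σ A) n →
    ∀ v → v ∈ bobMoves σ A n → ¬ PlayedBefore A (bobMoves σ A) n v × ¬ v ∈ A n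
  bob-legal-upTo σ legal A n adamLegal v v∈B =
    (λ played → proj₁ legalAt (playedBefore-local A B A′ B′ n
                   (λ j j<n → agreeA j (<⇒≤ j<n)) (λ j j<n → agreeB j (<⇒≤ j<n)) played)) ,
    (λ v∈A → proj₂ legalAt (subst (v ∈_) (agreeA n ≤-refl) v∈A))
    where
    B A′ B′ : ℕ → List V
    B  = bobMoves σ A
    A′ = truncate A n
    B′ = bobMoves σ A′
    agreeA : ∀ j → j ≤ n → A j ≡ A′ j
    agreeA j j≤n = sym (truncate-below A n j j≤n)
    agreeB : ∀ j → j ≤ n → B j ≡ B′ j
    agreeB j j≤n = bobMoves-local σ A A′ j (λ i i≤j → agreeA i (≤-trans i≤j j≤n))
    adamLegal′ : AdamLegal A′ B′
    adamLegal′ j w w∈A′ played with j ≤? n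
    ... | no  _ with () ← w∈A′
    ... | yes j≤n = adamLegal j j≤n w w∈A′
      (playedBefore-local A′ B′ A B j
        (λ i i<j → sym (agreeA i (<⇒≤ (<-≤-trans i<j j≤n))))
        (λ i i<j → sym (agreeB i (<⇒≤ (<-≤-trans i<j j≤n)))) played)
    legalAt : ¬ PlayedBefore A′ B′ n v × ¬ v ∈ A′ n
    legalAt = legal A′ adamLegal′ n v (subst (v ∈_) (agreeB n ≤-refl) v∈B)

recentTimes : ℕ → ℕ → List ℕ
recentTimes zero    t       = []
recentTimes (suc c) zero    = []
recentTimes (suc c) (suc t) = t ∷ recentTimes c t

∈-recentTimes⁻ : ∀ c t {s} → s ∈ recentTimes c t → s < t × t ≤ s + c
∈-recentTimes⁻ (suc c) (suc t) (here refl) =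
  ≤-refl , ≤-trans (s≤s (m≤m+n t c)) (≤-reflexive (sym (+-suc t c)))
∈-recentTimes⁻ (suc c) (suc t) {s} (there s∈) with ∈-recentTimes⁻ c t s∈
... | s<t , t≤s+c = m≤n⇒m≤1+n s<t , ≤-trans (s≤s t≤s+c) (≤-reflexive (sym (+-suc s c)))

∈-recentTimes⁺ : ∀ c t {s} → s < t → t ≤ s + c → s ∈ recentTimes c t
∈-recentTimes⁺ zero t {s} s<t t≤s+0 =
  ⊥-elim (<-irrefl (sym (+-identityʳ s)) (<-≤-trans s<t t≤s+0))
∈-recentTimes⁺ (suc c) (suc t) {s} s<1+t 1+t≤s+1+c with m≤n⇒m<n∨m≡n (≤-pred s<1+t)
... | inj₁ s<t  = there (∈-recentTimes⁺ c t s<t (≤-pred (≤-trans 1+t≤s+1+c (≤-reflexive (+-suc s c)))))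
... | inj₂ refl = here refl

module _ {V : Set} where

  recentMoves : (ℕ → List V) → ℕ → ℕ → List V
  recentMoves h c t = concatMap h (recentTimes c t)

  ∈-recentMoves⁻ : ∀ h c t {v} → v ∈ recentMoves h c t →
    ∃ λ s → (s < t × t ≤ s + c) × v ∈ h s
  ∈-recentMoves⁻ h c t v∈ with ∈-concat⁻′ (map h (recentTimes c t)) v∈
  ... | xs , v∈xs , xs∈ with ∈-map⁻ h xs∈
  ... | s , s∈ , refl = s , ∈-recentTimes⁻ c t s∈ , v∈xs

  ∈-recentMoves⁺ : ∀ h c t {s v} → s < t → t ≤ s + c → v ∈ h s → v ∈ recentMoves h c t
  ∈-recentMoves⁺ h c t s<t t≤s+c v∈ = ∈-concat⁺′ v∈ (∈-map⁺ h (∈-recentTimes⁺ c t s<t t≤s+c))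

  recentMoves-local : ∀ h h′ c t → (∀ s → s < t → h s ≡ h′ s) → recentMoves h c t ≡ recentMoves h′ c t
  recentMoves-local h h′ c t agree =
    cong concat (map-cong-local (All.tabulate (λ s∈ → agree _ (proj₁ (∈-recentTimes⁻ c t s∈)))))

module Schedule (m : ℕ) where

  M : ℕ
  M = suc m

  slot : ℕ → Fin M → ℕ
  slot n i = n * M + toℕ i

  roundOf : ℕ → ℕ
  roundOf t = t / M

  gameOf : ℕ → Fin M
  gameOf t = t mod M

  open ≡-Reasoning

  slot-decode : ∀ t → slot (roundOf t) (gameOf t) ≡ t
  slot-decode t = begin
    t / M * M + toℕ (t mod M) ≡⟨ cong (t / M * M +_) (toℕ-fromℕ< _) ⟩
    t / M * M + t % M         ≡⟨ +-comm (t / M * M) (t % M) ⟩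
    t % M + t / M * M         ≡⟨ sym (m≡m%n+[m/n]*n t M) ⟩
    t                         ∎

  gameOf-slot : ∀ n i → gameOf (slot n i) ≡ i
  gameOf-slot n i = toℕ-injective (begin
    toℕ (slot n i mod M)  ≡⟨ toℕ-fromℕ< _ ⟩
    (n * M + toℕ i) % M   ≡⟨ cong (_% M) (+-comm (n * M) (toℕ i)) ⟩
    (toℕ i + n * M) % M   ≡⟨ [m+kn]%n≡m%n (toℕ i) n M ⟩
    toℕ i % M             ≡⟨ m<n⇒m%n≡m (toℕ<n i) ⟩
    toℕ i                 ∎)

  roundOf-slot : ∀ n i → roundOf (slot n i) ≡ n
  roundOf-slot n i = begin
    (n * M + toℕ i) / M    ≡⟨ +-distrib-/ (n * M) (toℕ i) remainders<M ⟩
    n * M / M + toℕ i / M  ≡⟨ cong₂ _+_ (m*n/n≡m n M) (m<n⇒m/n≡0 (toℕ<n i)) ⟩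
    n + 0                  ≡⟨ +-identityʳ n ⟩
    n                      ∎
    where
    remainders<M : n * M % M + toℕ i % M < M
    remainders<M = subst (_< M) (sym (cong₂ _+_ (m*n%n≡0 n M) (m<n⇒m%n≡m (toℕ<n i)))) (toℕ<n i)

  slot-injective : ∀ {n n′ i j} → slot n i ≡ slot n′ j → n ≡ n′ × i ≡ j
  slot-injective {n} {n′} {i} {j} eq =
    trans (sym (roundOf-slot n i)) (trans (cong roundOf eq) (roundOf-slot n′ j)) ,
    trans (sym (gameOf-slot n i)) (trans (cong gameOf eq) (gameOf-slot n′ j))

  slot-next : ∀ n i → slot (suc n) i ≡ suc (slot n i + m)
  slot-next n i = begin
    (M + n * M) + toℕ i  ≡⟨ +-assoc M (n * M) (toℕ i) ⟩
    suc (m + slot n i)   ≡⟨ cong suc (+-comm m (slot n i)) ⟩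
    suc (slot n i + m)   ∎

  slot-mono : ∀ {n n′} i → n ≤ n′ → slot n i ≤ slot n′ i
  slot-mono i n≤n′ = +-monoˡ-≤ (toℕ i) (*-monoˡ-≤ M n≤n′)

  slot-gap : ∀ {n n′} i → n < n′ → slot n i + m < slot n′ i
  slot-gap {n} i n<n′ = ≤-trans (≤-reflexive (sym (slot-next n i))) (slot-mono i n<n′)

  slot-soon : ∀ s i → ∃ λ n → s ≤ slot n i × slot n i ≤ s + m
  slot-soon zero    i = 0 , z≤n , toℕ≤pred[n] i
  slot-soon (suc s) i with slot-soon s i
  ... | n , s≤slot , slot≤s+m with m≤n⇒m<n∨m≡n s≤slot
  ...   | inj₁ s<slot = n , s<slot , m≤n⇒m≤1+n slot≤s+m
  ...   | inj₂ refl   = suc n , ≤-trans (s≤s (m≤m+n s m)) (≤-reflexive (sym (slot-next n i))) ,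
                        ≤-reflexive (slot-next n i)

module Interleaving {V : Set} (m : ℕ) (σ : Fin (suc m) → BobStrategy V)
  (σ-legal : ∀ i A → AdamLegal A (bobMoves (σ i) A) → BobLegal A (bobMoves (σ i) A)) where

  open Schedule m

  adamIn : (ℕ → List V) → Fin M → ℕ → List V
  adamIn h i n = recentMoves h m (slot n i)

  globalStep : ℕ → (ℕ → List V) → List V
  globalStep t h = bobMoves (σ (gameOf t)) (adamIn h (gameOf t)) (roundOf t)

  -- Round j ≤ roundOf t of game i = gameOf t happens no later than t, so the
  -- step only consults moves before t.
  globalStep-local : ∀ t h h′ → (∀ s → s < t → h s ≡ h′ s) → globalStep t h ≡ globalStep t h′
  globalStep-local t h h′ agree = bobMoves-local (σ (gameOf t)) _ _ (roundOf t) λ j j≤round →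
    recentMoves-local h h′ m (slot j (gameOf t)) λ s s<slot →
      agree s (<-≤-trans s<slot (≤-trans (slot-mono (gameOf t) j≤round) (≤-reflexive (slot-decode t))))

  open CourseOfValues [] globalStep globalStep-local
    using () renaming (sequence to moves; sequence-recurrence to moves-recurrence)

  adam bob : Fin M → ℕ → List V
  adam = adamIn moves
  bob i = bobMoves (σ i) (adam i)

  open ≡-Reasoning

  bob≡moves : ∀ i n → bob i n ≡ moves (slot n i)
  bob≡moves i n = begin
    bob i n                      ≡⟨ cong₂ bob (sym (gameOf-slot n i)) (sym (roundOf-slot n i)) ⟩
    globalStep (slot n i) moves  ≡⟨ sym (moves-recurrence (slot n i)) ⟩
    moves (slot n i)             ∎

  moves≡bob : ∀ t → moves t ≡ bob (gameOf t) (roundOf t)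
  moves≡bob t = trans (cong moves (sym (slot-decode t))) (sym (bob≡moves (gameOf t) (roundOf t)))

  playedBefore⇒early : ∀ i n {v} → PlayedBefore (adam i) (bob i) n v →
    ∃ λ s → s + m < slot n i × v ∈ moves s
  playedBefore⇒early i n (j , j<n , inj₁ v∈adam) with ∈-recentMoves⁻ moves m (slot j i) v∈adam
  ... | s , (s<slot , _) , v∈s = s , <-trans (+-monoˡ-< m s<slot) (slot-gap i j<n) , v∈s
  playedBefore⇒early i n {v} (j , j<n , inj₂ v∈bob) =
    slot j i , slot-gap i j<n , subst (v ∈_) (bob≡moves i j) v∈bob

  early⇒playedBefore : ∀ i n {s v} → s + m < slot n i → v ∈ moves s →
    PlayedBefore (adam i) (bob i) n v
  early⇒playedBefore i n {s} {v} s+m<slot v∈s with slot-soon s i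
  ... | j , s≤slot , slot≤s+m = j , j<n , claimed
    where
    j<n : j < n
    j<n with n ≤? j
    ... | yes n≤j = ⊥-elim (<-irrefl refl (<-≤-trans (≤-<-trans slot≤s+m s+m<slot) (slot-mono i n≤j)))
    ... | no  n≰j = ≰⇒> n≰j
    claimed : v ∈ adam i j ⊎ v ∈ bob i j
    claimed with m≤n⇒m<n∨m≡n s≤slot
    ... | inj₁ s<slot = inj₁ (∈-recentMoves⁺ moves m (slot j i) s<slot slot≤s+m v∈s)
    ... | inj₂ refl   = inj₂ (subst (v ∈_) (sym (bob≡moves i j)) v∈s)

  Fresh : ℕ → Set
  Fresh t = ∀ s → s < t → ∀ v → v ∈ moves t → ¬ v ∈ moves s

  adam-legal-at : ∀ i n → (∀ s → s < slot n i → Fresh s) →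
    ∀ v → v ∈ adam i n → ¬ PlayedBefore (adam i) (bob i) n v
  adam-legal-at i n fresh-before v v∈adam played
    with ∈-recentMoves⁻ moves m (slot n i) v∈adam | playedBefore⇒early i n played
  ... | s , (s<slot , slot≤s+m) , v∈s | s′ , s′+m<slot , v∈s′ =
    fresh-before s s<slot s′ (+-cancelʳ-< m s′ s (<-≤-trans s′+m<slot slot≤s+m)) v v∈s v∈s′

  -- Adam has so far been legal in game i, so Bob's answer
  -- avoids both the older moves (played before round n) and the recent ones
  -- (Adam's current move).
  module FreshStep (t : ℕ) (fresh-below : ∀ {s} → s < t → Fresh s) where

    i : Fin M
    i = gameOf t

    n : ℕ
    n = roundOf t

    t≡slot : t ≡ slot n i
    t≡slot = sym (slot-decode t)

    adam-legal-upTo : AdamLegalUpTo (adam i) (bob i) n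
    adam-legal-upTo j j≤n = adam-legal-at i j λ s s<slot →
      fresh-below (<-≤-trans s<slot (≤-trans (slot-mono i j≤n) (≤-reflexive (sym t≡slot))))

    bob-legal-now : ∀ v → v ∈ moves t → ¬ PlayedBefore (adam i) (bob i) n v × ¬ v ∈ adam i n
    bob-legal-now v v∈t =
      bob-legal-upTo (σ i) (σ-legal i) (adam i) n adam-legal-upTo v (subst (v ∈_) (moves≡bob t) v∈t)

    fresh-step : Fresh t
    fresh-step s s<t v v∈t v∈s with s + m <? slot n i
    ... | yes s+m<slot = proj₁ (bob-legal-now v v∈t) (early⇒playedBefore i n s+m<slot v∈s)
    ... | no  s+m≮slot = proj₂ (bob-legal-now v v∈t)
      (∈-recentMoves⁺ moves m (slot n i) (subst (s <_) t≡slot s<t) (≮⇒≥ s+m≮slot) v∈s)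

  fresh : ∀ t → Fresh t
  fresh = <-rec Fresh FreshStep.fresh-step

  adam-legal : ∀ i → AdamLegal (adam i) (bob i)
  adam-legal i n = adam-legal-at i n (λ s _ → fresh s)

  -- A vertex claimed in game i by either player is claimed by Bob in some
  -- game, since Adam only plays what Bob claimed elsewhere.
  claimed-by-bob : ∀ i {v} → (∃ λ n → v ∈ adam i n ⊎ v ∈ bob i n) → ∃ λ j → ∃ λ r → v ∈ bob j r
  claimed-by-bob i {v} (n , inj₂ v∈bob)  = i , n , v∈bob
  claimed-by-bob i {v} (n , inj₁ v∈adam) with ∈-recentMoves⁻ moves m (slot n i) v∈adam
  ... | s , _ , v∈s = gameOf s , roundOf s , subst (v ∈_) (moves≡bob s) v∈s

  bob-disjoint : ∀ i j n r {v} → v ∈ bob i n → v ∈ bob j r → i ≡ j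
  bob-disjoint i j n r {v} v∈bobᵢ v∈bobⱼ
    with <-cmp (slot n i) (slot r j) | subst (v ∈_) (bob≡moves i n) v∈bobᵢ | subst (v ∈_) (bob≡moves j r) v∈bobⱼ
  ... | tri< earlier _ _ | v∈s | v∈t = ⊥-elim (fresh (slot r j) (slot n i) earlier v v∈t v∈s)
  ... | tri≈ _ same _    | _   | _   = proj₂ (slot-injective {n} {r} same)
  ... | tri> _ _ later   | v∈s | v∈t = ⊥-elim (fresh (slot n i) (slot r j) later v v∈s v∈t)

lemma4p4 : {V : Set} (H : SimpleGraph V) (M k : ℕ)
    (W : Fin M → V → Set) (Hs : Fin M → SimpleGraph V) →
    (∀ v → ∃ λ i → W i v) →
    (∀ i → Hs i ⊆ᴱ H) →
    (∀ i → BobHasWinningStrategy (Hs i) (W i) k) →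
    Σ (Fin M → V → Set) λ P →
    (∀ v → ∃ λ i → P i v) ×
    (∀ i j v → P i v → P j v → i ≡ j) ×
    (∀ i → HasKPowerHamPath (Hs i) k (P i))
lemma4p4 H zero k W Hs covers _ win = (λ ()) , (λ v → ⊥-elim (no-game (proj₁ (covers v)))) , (λ ()) , (λ ())
  where
  no-game : Fin 0 → ⊥
  no-game ()
lemma4p4 {V} H (suc m) k W Hs covers _ win = P , covered , disjoint , λ i → proj₂ (outcome i)
  where
  open Interleaving m (λ i → proj₁ (win i)) (λ i A legal → proj₁ (proj₂ (win i) A legal))

  outcome : ∀ i → BobWins (Hs i) (W i) k (adam i) (bob i)
  outcome i = proj₂ (proj₂ (win i) (adam i) (adam-legal i))

  P : Fin (suc m) → V → Set
  P i v = ∃ λ n → v ∈ bob i n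

  covered : ∀ v → ∃ λ i → P i v
  covered v = claimed-by-bob i {v} (proj₁ (outcome i) v v∈Wᵢ)
    where
    i : Fin (suc m)
    i = proj₁ (covers v)
    v∈Wᵢ : W i v
    v∈Wᵢ = proj₂ (covers v)

  disjoint : ∀ i j v → P i v → P j v → i ≡ j
  disjoint i j v (n , v∈bobᵢ) (r , v∈bobⱼ) = bob-disjoint i j n r {v} v∈bobᵢ v∈bobⱼ
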